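{- Let $k$ be a positive integer, let $(G,x,y)$ be a $2$-connected rooted graph, let $l$ be an integer and let $H=G[S,T]$ be an $l$-core of $G$ with respect to $(x,y)$. Let $C$ be the component of $G-V(H)$ containing $y$. If either (i) $l\ge k$, or (ii) $l=k-1$ and $E_G(T,V(C))\neq\emptyset$, then $G$ contains $k$ paths from $x$ to $y$ satisfying the length condition.
   Context: All graphs are finite and simple. A rooted graph $(G,x,y)$ ($x\ne y$ vertices of $G$) is $2$-connected if $G$ is connected of order at least $3$ with at most two end blocks and every end block of $G$ contains at least one of $x,y$ as a non-cut vertex. For disjoint $S,T\subseteq V(G)$, $E_G(S,T)$ is the set of edges between $S$ and $T$, $e_G(S,T)=|E_G(S,T)|$, and $G[S,T]$ is the bipartite graph with vertex set $S\cup T$, edge set $E_G(S,T)$ and partite sets $S,T$. A bipartite subgraph $H=G[S,T]$ is an $l$-core with respect to $(x,y)$ if (C1) $H$ is complete bipartite and $|T|\ge|S|=l+1\ge 2$; (C2) $x\in S$ and $y\notin V(H)$; (C3) $e_G(v,S)\le l$ for every $v\in V(G)\setminus(V(H)\cup\{y\})$; (C4) $e_G(v,T\setminus\{v\})\le l+1$ for every $v\in V(G)\setminus(S\cup\{y\})$. A sequence of paths $H_1,\dots,H_k$ satisfies the length condition if $|E(H_1)|\ge2$ and $|E(H_{i+1})|-|E(H_i)|=2$ for $1\le i\le k-1$. -}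

module Defs where

open import Data.Nat using (ℕ; suc; _+_; _∸_; _≤_)
open import Data.Bool using (Bool; true; false)
open import Data.Fin using (Fin; toℕ)
open import Data.Fin.Subset using (Subset; _∈_; _∉_; _⊆_; _∩_; _∪_; ∁; ⁅_⁆; _-_; ∣_∣)
import Data.Fin.Subset as Sub
open import Data.Vec using (tabulate)
open import Data.List using (List; []; _∷_; length)
open import Data.List.Relation.Unary.All using (All)
open import Data.List.Relation.Unary.Unique.Propositional using (Unique)
open import Data.Product using (Σ; ∃; ∃-syntax; _×_; _,_)
open import Data.Sum using (_⊎_)
open import Relation.Binary.PropositionalEquality using (_≡_; _≢_)
open import Relation.Nullary using (¬_)

record Graph (n : ℕ) : Set where
  field
    adj     : Fin n → Fin n → Bool
    symm    : ∀ u v → adj u v ≡ adj v u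
    irrefl  : ∀ v → adj v v ≡ false

module _ {n : ℕ} (G : Graph n) where
  open Graph G

  Adj : Fin n → Fin n → Set
  Adj u v = adj u v ≡ true

  N : Fin n → Subset n
  N v = tabulate (adj v)

  eV : Fin n → Subset n → ℕ
  eV v S = ∣ S ∩ N v ∣

  data WalkList : Fin n → Fin n → List (Fin n) → Set where
    one  : ∀ {v} → WalkList v v (v ∷ [])
    cons : ∀ {u v w vs} → Adj u v → WalkList v w vs → WalkList u w (u ∷ vs)

  ReachIn : Subset n → Fin n → Fin n → Set
  ReachIn W u v = ∃[ vs ] (WalkList u v vs × All (_∈ W) vs)

  -- the induced subgraph G[W] is connected (the empty set counts as connected)
  ConnectedSet : Subset n → Set
  ConnectedSet W = ∀ u v → u ∈ W → v ∈ W → ReachIn W u v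

  Connected : Set
  Connected = ConnectedSet Sub.⊤

  CutVertex : Fin n → Set
  CutVertex v = ¬ ConnectedSet (Sub.⊤ - v)

  Nonseparable : Subset n → Set
  Nonseparable B = ConnectedSet B × (∀ v → v ∈ B → ConnectedSet (B - v))

  Block : Subset n → Set
  Block B = (∃[ v ] v ∈ B) × Nonseparable B × (∀ B' → B ⊆ B' → Nonseparable B' → B' ⊆ B)

  EndBlock : Subset n → Set
  EndBlock B = Block B × (∀ u v → u ∈ B → v ∈ B → CutVertex u → CutVertex v → u ≡ v)

  TwoConnectedRooted : Fin n → Fin n → Set
  TwoConnectedRooted x y =
    x ≢ y × Connected × 3 ≤ n
    × (∀ B₁ B₂ B₃ → EndBlock B₁ → EndBlock B₂ → EndBlock B₃ →
         (B₁ ≡ B₂) ⊎ (B₁ ≡ B₃) ⊎ (B₂ ≡ B₃))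
    × (∀ B → EndBlock B → (x ∈ B × ¬ CutVertex x) ⊎ (y ∈ B × ¬ CutVertex y))

  IsCore : Fin n → Fin n → ℕ → Subset n → Subset n → Set
  IsCore x y l S T =
    (∀ v → v ∈ S → v ∉ T)
    × (∀ s t → s ∈ S → t ∈ T → Adj s t)
    × ∣ S ∣ ≡ suc l × 2 ≤ ∣ S ∣ × ∣ S ∣ ≤ ∣ T ∣
    × x ∈ S × y ∉ (S ∪ T)
    × (∀ v → v ∉ (S ∪ T) → v ≢ y → eV v S ≤ l)
    × (∀ v → v ∉ S → v ≢ y → eV v (T - v) ≤ suc l)

  Path : Fin n → Fin n → Set
  Path x y = Σ (List (Fin n)) λ vs → WalkList x y vs × Unique vs

  len : ∀ {x y} → Path x y → ℕ
  len (vs , _) = length vs ∸ 1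

  LengthCondPaths : Fin n → Fin n → ℕ → Set
  LengthCondPaths x y k =
    Σ (Fin k → Path x y) λ P →
      (∀ i → toℕ i ≡ 0 → 2 ≤ len (P i))
      × (∀ i j → toℕ j ≡ suc (toℕ i) → len (P j) ≡ len (P i) + 2)

module Submission where

open import Defs
open import Data.Nat using (ℕ; zero; suc; _+_; _≤_; _<_; z≤n; s≤s; s≤s⁻¹)
open import Data.Nat.Properties using (≤-trans; ≤-refl; ≤-reflexive; <-≤-trans; m≤n⇒m≤1+n; m≤n+m; +-suc; +-comm)
open import Data.Bool using (true; false)
import Data.Bool as Bool
open import Data.Fin using (Fin; zero; suc; toℕ; _≟_)
open import Data.Fin.Properties using (any?; suc-injective; toℕ<n)
open import Data.Fin.Subset using (Subset; _∈_; _∉_; _⊆_; _∪_; ∁; ⁅_⁆; _-_; _─_; ∣_∣; ⊤; Nonempty)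
open import Data.Fin.Subset.Properties
open import Data.Vec using ([]; _∷_; tabulate; here; there)
open import Data.Vec.Properties using (lookup∘tabulate; lookup⇒[]=; []=⇒lookup)
open import Data.List using (List; []; _∷_; length; _++_; map; take)
open import Data.List.Properties using (length-map; length-++)
open import Data.List.Relation.Unary.All using (All; []; _∷_)
import Data.List.Relation.Unary.All as All
import Data.List.Relation.Unary.All.Properties as All
open import Data.List.Relation.Unary.Any using (here; there)
open import Data.List.Relation.Unary.Unique.Propositional using (Unique; []; _∷_)
import Data.List.Relation.Unary.Unique.Propositional.Properties as Unique
open import Data.List.Relation.Binary.Disjoint.Propositional using (Disjoint)
open import Data.List.Membership.Propositional using () renaming (_∈_ to _∈ₗ_)
open import Data.Product using (∃-syntax; _×_; _,_; proj₁; proj₂)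
open import Data.Sum using (_⊎_; inj₁; inj₂; [_,_]′)
open import Data.Empty using (⊥-elim)
open import Relation.Binary.PropositionalEquality using (_≡_; _≢_; refl; sym; trans; cong; subst; ≢-sym; module ≡-Reasoning)
open import Relation.Nullary using (¬_; Dec; yes; no; does; contradiction)
open import Relation.Nullary.Decidable using (_×-dec_; map′; ¬?; dec-true)

-- The k paths are "ladders": as H is complete bipartite,
--   x t₁ s₁ t₂ s₂ … tᵢ sᵢ  followed by a fixed tail from some t₀ ∈ T through C to y
-- is an x–y path for every i, and its length grows by exactly 2 with i.  So k such paths
-- exist once k - 1 rungs tⱼ ∈ T, sⱼ ∈ S - x avoid the tail, which |S| = l + 1 ≤ |T| guarantees.
-- The tail enters C by an edge zc with z ∈ V(H) - x: in case (ii) the given edge from T; in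
-- case (i) such an edge exists since otherwise x would cut off a part of G (a branch) which
-- contains an end block avoiding y in which x is a cut vertex, contradicting 2-connectivity.

x∈p─q⇒x∉q : ∀ {n} {x : Fin n} (p q : Subset n) → x ∈ p ─ q → x ∉ q
x∈p─q⇒x∉q (true ∷ p) (false ∷ q) here ()
x∈p─q⇒x∉q (_ ∷ p) (_ ∷ q) (there x∈p─q) (there x∈q) = x∈p─q⇒x∉q p q x∈p─q x∈q

x∈p-y⇒x≢y : ∀ {n} {x y : Fin n} (p : Subset n) → x ∈ p - y → x ≢ y
x∈p-y⇒x≢y {y = y} p x∈p-y refl = x∈p─q⇒x∉q p ⁅ y ⁆ x∈p-y (x∈⁅x⁆ y)

x∈p-y⇒x∈p : ∀ {n} {x y : Fin n} (p : Subset n) → x ∈ p - y → x ∈ p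
x∈p-y⇒x∈p {y = y} p = p─q⊆p p ⁅ y ⁆

∈∪⁅⁆⁺ : ∀ {n} {D : Subset n} {c z} → z ∈ D ⊎ z ≡ c → z ∈ D ∪ ⁅ c ⁆
∈∪⁅⁆⁺ (inj₁ z∈D) = x∈p∪q⁺ (inj₁ z∈D)
∈∪⁅⁆⁺ {c = c} (inj₂ refl) = x∈p∪q⁺ (inj₂ (x∈⁅x⁆ c))

∈∪⁅⁆⁻ : ∀ {n} {D : Subset n} {c z} → z ∈ D ∪ ⁅ c ⁆ → z ∈ D ⊎ z ≡ c
∈∪⁅⁆⁻ {D = D} {c} z∈ with x∈p∪q⁻ D ⁅ c ⁆ z∈
... | inj₁ z∈D = inj₁ z∈D
... | inj₂ z∈⁅c⁆ = inj₂ (x∈⁅y⁆⇒x≡y c z∈⁅c⁆)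

∈∁∪⁅⁆⁺ : ∀ {n} {D : Subset n} {c z} → z ∉ D → z ≢ c → z ∈ ∁ (D ∪ ⁅ c ⁆)
∈∁∪⁅⁆⁺ z∉D z≢c = x∉p⇒x∈∁p (λ z∈ → [ z∉D , z≢c ]′ (∈∪⁅⁆⁻ z∈))

∈∁∪⁅⁆⁻ : ∀ {n} {D : Subset n} {c z} → z ∈ ∁ (D ∪ ⁅ c ⁆) → z ∉ D × z ≢ c
∈∁∪⁅⁆⁻ z∈ = (λ z∈D → x∈∁p⇒x∉p z∈ (∈∪⁅⁆⁺ (inj₁ z∈D))) , (λ z≡c → x∈∁p⇒x∉p z∈ (∈∪⁅⁆⁺ (inj₂ z≡c)))

∣p∣≤1+∣p-x∣ : ∀ {n} (p : Subset n) x → ∣ p ∣ ≤ suc ∣ p - x ∣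
∣p∣≤1+∣p-x∣ (true ∷ p) zero = s≤s (≤-reflexive (cong ∣_∣ (sym (p─⊥≡p p))))
∣p∣≤1+∣p-x∣ (false ∷ p) zero = m≤n⇒m≤1+n (≤-reflexive (cong ∣_∣ (sym (p─⊥≡p p))))
∣p∣≤1+∣p-x∣ (true ∷ p) (suc x) = s≤s (∣p∣≤1+∣p-x∣ p x)
∣p∣≤1+∣p-x∣ (false ∷ p) (suc x) = ∣p∣≤1+∣p-x∣ p x

size⇒nonempty : ∀ {n} {p : Subset n} → 1 ≤ ∣ p ∣ → Nonempty p
size⇒nonempty {n} {p} 1≤∣p∣ with nonempty? p
... | yes ne = ne
... | no ¬ne = contradiction (subst (1 ≤_) (trans (cong ∣_∣ (Empty-unique ¬ne)) (∣⊥∣≡0 n)) 1≤∣p∣) λ ()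

other-element : ∀ {n} (p : Subset n) (x : Fin n) → 2 ≤ ∣ p ∣ → ∃[ s ] (s ∈ p × s ≢ x)
other-element p x 2≤∣p∣ =
  let (s , s∈p-x) = size⇒nonempty (s≤s⁻¹ (≤-trans 2≤∣p∣ (∣p∣≤1+∣p-x∣ p x)))
  in s , x∈p-y⇒x∈p p s∈p-x , x∈p-y⇒x≢y p s∈p-x

subsetOf : ∀ {n} {P : Fin n → Set} → (∀ i → Dec (P i)) → Subset n
subsetOf P? = tabulate (λ i → does (P? i))

∈-subsetOf⁺ : ∀ {n} {P : Fin n → Set} (P? : ∀ i → Dec (P i)) {i : Fin n} → P i → i ∈ subsetOf P?
∈-subsetOf⁺ P? {i} Pi = lookup⇒[]= i _ (trans (lookup∘tabulate _ i) (dec-true (P? i) Pi))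

∈-subsetOf⁻ : ∀ {n} {P : Fin n → Set} (P? : ∀ i → Dec (P i)) {i : Fin n} → i ∈ subsetOf P? → P i
∈-subsetOf⁻ P? {i} i∈ with P? i | trans (sym (lookup∘tabulate _ i)) ([]=⇒lookup i∈)
... | yes Pi | _ = Pi
... | no _ | ()

elements : ∀ {n} → Subset n → List (Fin n)
elements [] = []
elements (true ∷ p) = zero ∷ map suc (elements p)
elements (false ∷ p) = map suc (elements p)

length-elements : ∀ {n} (p : Subset n) → length (elements p) ≡ ∣ p ∣
length-elements [] = refl
length-elements (true ∷ p) = cong suc (trans (length-map suc (elements p)) (length-elements p))
length-elements (false ∷ p) = trans (length-map suc (elements p)) (length-elements p)

elements⊆ : ∀ {n} (p : Subset n) → All (_∈ p) (elements p)
elements⊆ [] = []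
elements⊆ (true ∷ p) = here ∷ All.map⁺ (All.map there (elements⊆ p))
elements⊆ (false ∷ p) = All.map⁺ (All.map there (elements⊆ p))

elements-unique : ∀ {n} (p : Subset n) → Unique (elements p)
elements-unique [] = []
elements-unique (true ∷ p) = All.map⁺ (All.tabulate (λ _ ())) ∷ Unique.map⁺ suc-injective (elements-unique p)
elements-unique (false ∷ p) = Unique.map⁺ suc-injective (elements-unique p)

unique-length≤ : ∀ {n} (p : Subset n) {xs : List (Fin n)} → Unique xs → All (_∈ p) xs → length xs ≤ ∣ p ∣
unique-length≤ p [] [] = z≤n
unique-length≤ p {x ∷ xs} (x∉xs ∷ u) (x∈p ∷ xs⊆p) =
  <-≤-trans (s≤s (unique-length≤ (p - x) u (All.zipWith into (x∉xs , xs⊆p)))) (x∈p⇒∣p-x∣<∣p∣ x∈p)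
  where
  into : ∀ {v} → x ≢ v × v ∈ p → v ∈ p - x
  into (x≢v , v∈p) = x∈p∧x≢y⇒x∈p-y v∈p (≢-sym x≢v)

interleave : ∀ {A : Set} → List A → List A → List A
interleave (a ∷ as) (b ∷ bs) = a ∷ b ∷ interleave as bs
interleave _ _ = []

interleave-All : ∀ {A : Set} {P : A → Set} {as bs} → All P as → All P bs → All P (interleave as bs)
interleave-All (pa ∷ pas) (pb ∷ pbs) = pa ∷ pb ∷ interleave-All pas pbs
interleave-All [] _ = []
interleave-All (_ ∷ _) [] = []

interleave-unique : ∀ {n} (p : Subset n) {as bs : List (Fin n)} → All (_∈ p) as → All (_∉ p) bs →
                    Unique as → Unique bs → Unique (interleave as bs)
interleave-unique p {a ∷ as} {b ∷ bs} (a∈p ∷ as⊆p) (b∉p ∷ bs∩p=∅) (a∉as ∷ uas) (b∉bs ∷ ubs) =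
  (a≢b ∷ interleave-All a∉as (All.map (λ v∉p a≡v → v∉p (subst (_∈ p) a≡v a∈p)) bs∩p=∅))
  ∷ interleave-All (All.map (λ v∈p b≡v → b∉p (subst (_∈ p) (sym b≡v) v∈p)) as⊆p) b∉bs
  ∷ interleave-unique p as⊆p bs∩p=∅ uas ubs
  where
  a≢b : a ≢ b
  a≢b a≡b = b∉p (subst (_∈ p) a≡b a∈p)
interleave-unique p {[]} _ _ _ _ = []
interleave-unique p {_ ∷ _} {[]} _ _ _ _ = []

length-interleave-take : ∀ {A : Set} i (as bs : List A) → i ≤ length as → i ≤ length bs →
                         length (interleave (take i as) (take i bs)) ≡ i + i
length-interleave-take zero as bs _ _ = refl
length-interleave-take (suc i) (a ∷ as) (b ∷ bs) (s≤s i≤as) (s≤s i≤bs) =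
  cong suc (trans (cong suc (length-interleave-take i as bs i≤as i≤bs)) (sym (+-suc i i)))

module Walks {n : ℕ} (G : Graph n) where
  open Graph G
  open import Data.List.Membership.DecPropositional (_≟_ {n}) using () renaming (_∈?_ to _∈ₗ?_)

  adj-sym : ∀ {u v} → Adj G u v → Adj G v u
  adj-sym {u} {v} uv = trans (symm v u) uv

  -- u reaches v by a walk all of whose vertices satisfy P;  ReachIn G W  is  Reach (_∈ W)
  Reach : (Fin n → Set) → Fin n → Fin n → Set
  Reach P u v = ∃[ vs ] (WalkList G u v vs × All P vs)

  PathIn : (Fin n → Set) → Fin n → Fin n → Set
  PathIn P u v = ∃[ vs ] (WalkList G u v vs × Unique vs × All P vs)

  module _ {P : Fin n → Set} where

    walk-start : ∀ {u v vs} → WalkList G u v vs → All P vs → P u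
    walk-start one (pu ∷ _) = pu
    walk-start (cons _ _) (pu ∷ _) = pu

    walk-end : ∀ {u v vs} → WalkList G u v vs → All P vs → P v
    walk-end one (pv ∷ _) = pv
    walk-end (cons _ w) (_ ∷ ps) = walk-end w ps

    reach-refl : ∀ {u} → P u → Reach P u u
    reach-refl pu = _ , one , pu ∷ []

    reach-edge : ∀ {u v} → P u → P v → Adj G u v → Reach P u v
    reach-edge pu pv uv = _ , cons uv one , pu ∷ pv ∷ []

    reach-trans : ∀ {u v w} → Reach P u v → Reach P v w → Reach P u w
    reach-trans (_ , one , _) r = r
    reach-trans (_ , cons uv w , pu ∷ ps) r with reach-trans (_ , w , ps) r
    ... | _ , w' , ps' = _ , cons uv w' , pu ∷ ps'

    reach-sym : ∀ {u v} → Reach P u v → Reach P v u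
    reach-sym (_ , one , ps) = _ , one , ps
    reach-sym (_ , cons uv w , pu ∷ ps) =
      reach-trans (reach-sym (_ , w , ps)) (reach-edge (walk-start w ps) pu (adj-sym uv))

    suffix : ∀ {u w v ws} → WalkList G w v ws → Unique ws → All P ws → u ∈ₗ ws → PathIn P u v
    suffix one uq ps (here refl) = _ , one , uq , ps
    suffix (cons wv w) uq ps (here refl) = _ , cons wv w , uq , ps
    suffix (cons _ w) (_ ∷ uq) (_ ∷ ps) (there u∈) = suffix w uq ps u∈

    shorten : ∀ {u v vs} → WalkList G u v vs → All P vs → PathIn P u v
    shorten one ps = _ , one , [] ∷ [] , ps
    shorten {u} (cons uv w) (pu ∷ ps) with shorten w ps
    ... | ws , w' , uq , ps' with u ∈ₗ? ws
    ...   | yes u∈ws = suffix w' uq ps' u∈ws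
    ...   | no u∉ws = u ∷ ws , cons uv w' , All.¬Any⇒All¬ ws u∉ws ∷ uq , pu ∷ ps'

  reach-map : ∀ {P Q : Fin n → Set} {u v} → (∀ {z} → P z → Q z) → Reach P u v → Reach Q u v
  reach-map f (vs , w , ps) = vs , w , All.map f ps

  extend : ∀ {P : Fin n → Set} {u v w} → ¬ P u → Adj G u v → PathIn P v w → PathIn (λ z → P z ⊎ z ≡ u) u w
  extend {P} ¬Pu uv (vs , w , uq , ps) =
    _ , cons uv w , All.map (λ Pz u≡z → ¬Pu (subst P (sym u≡z) Pz)) ps ∷ uq , inj₂ refl ∷ All.map inj₁ ps

  walk-length : ∀ {u v vs} → u ≢ v → WalkList G u v vs → 2 ≤ length vs
  walk-length u≢u one = contradiction refl u≢u
  walk-length _ (cons _ one) = s≤s (s≤s z≤n)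
  walk-length _ (cons _ (cons _ _)) = s≤s (s≤s z≤n)

  adj? : ∀ u v → Dec (Adj G u v)
  adj? u v = adj u v Bool.≟ true

  -- reachability by walks with at most m vertices is decidable by recursion on m
  ReachWithin : ℕ → (Fin n → Set) → Fin n → Fin n → Set
  ReachWithin m P u v = ∃[ vs ] (WalkList G u v vs × All P vs × length vs ≤ m)

  reachWithin? : ∀ {P : Fin n → Set} → (∀ z → Dec (P z)) → ∀ m u v → Dec (ReachWithin m P u v)
  reachWithin? P? zero u v = no λ { (_ , one , _ , ()) ; (_ , cons _ _ , _ , ()) }
  reachWithin? P? (suc m) u v with P? u
  ... | no ¬pu = no λ { (_ , w , ps , _) → ¬pu (walk-start w ps) }
  ... | yes pu with u ≟ v
  ...   | yes refl = yes (_ , one , pu ∷ [] , s≤s z≤n)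
  ...   | no u≢v with any? (λ w → adj? u w ×-dec reachWithin? P? m w v)
  ...     | yes (w , uw , (_ , wv , ps , len≤m)) = yes (_ , cons uw wv , pu ∷ ps , s≤s len≤m)
  ...     | no ¬step = no λ { (_ , one , _ , _) → u≢v refl
                            ; (_ , cons uw wv , _ ∷ ps , s≤s len≤m) → ¬step (_ , uw , (_ , wv , ps , len≤m)) }

  -- since paths have at most n vertices, reachability itself is decidable
  reach? : ∀ {P : Fin n → Set} → (∀ z → Dec (P z)) → ∀ u v → Dec (Reach P u v)
  reach? P? u v = map′ forget viaPath (reachWithin? P? n u v)
    where
    forget : ReachWithin n _ u v → Reach _ u v
    forget (vs , w , ps , _) = vs , w , ps
    viaPath : Reach _ u v → ReachWithin n _ u v
    viaPath (_ , w , ps) with shorten w ps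
    ... | ws , w' , uq , ps' =
      ws , w' , ps' , ≤-trans (unique-length≤ ⊤ uq (All.tabulate (λ _ → ∈⊤))) (≤-reflexive (∣⊤∣≡n n))

  Closed : Subset n → Fin n → Set
  Closed D c = ∀ {u w} → u ∈ D → Adj G u w → w ∈ D ⊎ w ≡ c

  escape : ∀ {P : Fin n → Set} {D c u v vs} → Closed D c → WalkList G u v vs → All P vs →
           u ∈ D → v ∉ D → Reach (λ z → P z × (z ∈ D ⊎ z ≡ c)) u c
  escape cl one _ u∈D u∉D = contradiction u∈D u∉D
  escape {D = D} cl (cons {v = w} uw wv) (pu ∷ ps) u∈D v∉D with w ∈? D
  ... | yes w∈D = reach-trans (reach-edge (pu , inj₁ u∈D) (walk-start wv ps , inj₁ w∈D) uw) (escape cl wv ps w∈D v∉D)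
  ... | no w∉D with cl u∈D uw
  ...   | inj₁ w∈D = contradiction w∈D w∉D
  ...   | inj₂ refl = reach-edge (pu , inj₁ u∈D) (walk-start wv ps , inj₂ refl) uw

-- Branches: parts of G cut off by one vertex; each contains an end block (fixed outside vertex o)

module Branches {n : ℕ} (G : Graph n) (connected : Connected G) (o : Fin n) where
  open Walks G

  record Branch (c : Fin n) (D : Subset n) : Set where
    field
      c≢o : c ≢ o
      o∉D : o ∉ D
      c∉D : c ∉ D
      d : Fin n
      d∈D : d ∈ D
      closed : Closed D c

  ∈⊤- : ∀ {z w : Fin n} → z ≢ w → z ∈ ⊤ - w
  ∈⊤- z≢w = x∈p∧x≢y⇒x∈p-y ∈⊤ z≢w

  -- the vertex cutting off a branch is a cut vertex: every d–o walk passes through it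
  branch⇒cut : ∀ {c D} → Branch c D → CutVertex G c
  branch⇒cut {c} {D} br G-c-connected =
    let (_ , d⇝o , ps) = G-c-connected d o (∈⊤- d≢c) (∈⊤- (≢-sym c≢o))
        (_ , d⇝c , ps') = escape closed d⇝o ps d∈D o∉D
    in x∈p-y⇒x≢y ⊤ (proj₁ (walk-end d⇝c ps')) refl
    where
    open Branch br
    d≢c : d ≢ c
    d≢c d≡c = c∉D (subst (_∈ D) d≡c d∈D)

  Smaller : Subset n → Set
  Smaller D = ∃[ c' ] ∃[ D' ] (∣ D' ∣ < ∣ D ∣ × Branch c' D')

  module _ {c : Fin n} {D : Subset n} (br : Branch c D) where
    open Branch br

    shrink : ∀ {c' D' w} → D' ⊆ D → w ∈ D → w ∉ D' → Branch c' D' → Smaller D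
    shrink D'⊆D w∈D w∉D' br' = _ , _ , p⊂q⇒∣p∣<∣q∣ (D'⊆D , _ , w∈D , w∉D') , br'

    outside-closed : Closed (∁ (D ∪ ⁅ c ⁆)) c
    outside-closed {u} {w} u∈ uw with w ∈? D
    ... | yes w∈D = ⊥-elim ([ proj₁ (∈∁∪⁅⁆⁻ u∈) , proj₂ (∈∁∪⁅⁆⁻ u∈) ]′ (closed w∈D (adj-sym uw)))
    ... | no w∉D with w ≟ c
    ...   | yes w≡c = inj₂ w≡c
    ...   | no w≢c = inj₁ (∈∁∪⁅⁆⁺ w∉D w≢c)

    toC : ∀ {v} → v ∉ D → Reach (_∉ D) v c
    toC {v} v∉D with v ≟ c
    ... | yes refl = reach-refl c∉D
    ... | no v≢c =
      let (_ , v⇝d , ps) = connected v d ∈⊤ ∈⊤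
      in reach-map notInD (escape outside-closed v⇝d ps (∈∁∪⁅⁆⁺ v∉D v≢c) (λ d∈ → proj₁ (∈∁∪⁅⁆⁻ d∈) d∈D))
      where
      notInD : ∀ {z} → z ∈ ⊤ × (z ∈ ∁ (D ∪ ⁅ c ⁆) ⊎ z ≡ c) → z ∉ D
      notInD (_ , inj₁ z∈out) = proj₁ (∈∁∪⁅⁆⁻ z∈out)
      notInD (_ , inj₂ refl) = c∉D

    Separates : Fin n → Fin n → Set
    Separates w v = v ≢ w × ¬ Reach (_∈ ⊤ - w) c v

    separates? : ∀ w v → Dec (Separates w v)
    separates? w v = ¬? (v ≟ w) ×-dec ¬? (reach? (_∈? ⊤ - w) c v)

    -- the vertices that a vertex w of D separates from c form a smaller branch, cut off by w
    branchBeyond : ∀ {w v} → w ∈ D → Separates w v → Smaller D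
    branchBeyond {w} {v} w∈D w-sep-v = shrink D'⊆D w∈D (λ w∈D' → proj₁ (separated w∈D') refl) br'
      where
      D' = subsetOf (separates? w)
      separated : ∀ {z} → z ∈ D' → Separates w z
      separated = ∈-subsetOf⁻ (separates? w)
      avoidsW : ∀ {z} → z ∉ D → z ∈ ⊤ - w
      avoidsW z∉D = ∈⊤- λ { refl → z∉D w∈D }
      notSeparated : ∀ {z} → z ∉ D → z ∉ D'
      notSeparated z∉D z∈D' = proj₂ (separated z∈D') (reach-map avoidsW (reach-sym (toC z∉D)))
      D'⊆D : D' ⊆ D
      D'⊆D {z} z∈D' with z ∈? D
      ... | yes z∈D = z∈D
      ... | no z∉D = contradiction z∈D' (notSeparated z∉D)
      closed' : Closed D' w
      closed' {u} {z} u∈D' uz with z ≟ w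
      ... | yes z≡w = inj₂ z≡w
      ... | no z≢w with reach? (_∈? ⊤ - w) c z
      ...   | yes c⇝z = contradiction (reach-trans c⇝z (reach-edge (∈⊤- z≢w) (∈⊤- (proj₁ (separated u∈D'))) (adj-sym uz)))
                                      (proj₂ (separated u∈D'))
      ...   | no ¬c⇝z = inj₁ (∈-subsetOf⁺ (separates? w) (z≢w , ¬c⇝z))
      br' : Branch w D'
      br' = record { c≢o = λ { refl → o∉D w∈D } ; o∉D = notSeparated o∉D ; c∉D = λ w∈D' → proj₁ (separated w∈D') refl
                   ; d = v ; d∈D = ∈-subsetOf⁺ (separates? w) w-sep-v ; closed = closed' }

    cutOrSmaller : Smaller D ⊎ (∀ w → w ∈ D → ConnectedSet G (⊤ - w))
    cutOrSmaller with any? (λ w → any? (λ v → (w ∈? D) ×-dec separates? w v))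
    ... | yes (w , v , w∈D , w-sep-v) = inj₁ (branchBeyond w∈D w-sep-v)
    ... | no ¬sep = inj₂ λ w w∈D p q p∈ q∈ → reach-trans (reach-sym (fromC w∈D p∈)) (fromC w∈D q∈)
      where
      fromC : ∀ {w p} → w ∈ D → p ∈ ⊤ - w → Reach (_∈ ⊤ - w) c p
      fromC {w} {p} w∈D p∈ with reach? (_∈? ⊤ - w) c p
      ... | yes c⇝p = c⇝p
      ... | no ¬c⇝p = contradiction (w , p , w∈D , x∈p-y⇒x≢y ⊤ p∈ , ¬c⇝p) ¬sep

    -- either D is connected, or the part of D reachable inside D from one vertex is a smaller branch
    connOrSmaller : Smaller D ⊎ (∀ p q → p ∈ D → q ∈ D → Reach (_∈ D) p q)
    connOrSmaller with any? (λ p → any? (λ q → (p ∈? D) ×-dec (q ∈? D) ×-dec ¬? (reach? (_∈? D) p q)))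
    ... | yes (p , q , p∈D , q∈D , ¬p⇝q) = inj₁ (shrink R⊆D q∈D (λ q∈R → ¬p⇝q (∈-subsetOf⁻ (reach? (_∈? D) p) q∈R)) br')
      where
      R = subsetOf (reach? (_∈? D) p)
      R⊆D : R ⊆ D
      R⊆D z∈R = let (_ , p⇝z , ps) = ∈-subsetOf⁻ (reach? (_∈? D) p) z∈R in walk-end p⇝z ps
      closedR : Closed R c
      closedR {u} {w} u∈R uw with closed (R⊆D u∈R) uw
      ... | inj₂ w≡c = inj₂ w≡c
      ... | inj₁ w∈D = inj₁ (∈-subsetOf⁺ (reach? (_∈? D) p)
                              (reach-trans (∈-subsetOf⁻ (reach? (_∈? D) p) u∈R) (reach-edge (R⊆D u∈R) w∈D uw)))
      br' : Branch c R
      br' = record { c≢o = c≢o ; o∉D = λ o∈R → o∉D (R⊆D o∈R) ; c∉D = λ c∈R → c∉D (R⊆D c∈R)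
                   ; d = p ; d∈D = ∈-subsetOf⁺ (reach? (_∈? D) p) (reach-refl p∈D) ; closed = closedR }
    ... | no ¬split = inj₂ D-connected
      where
      D-connected : ∀ p q → p ∈ D → q ∈ D → Reach (_∈ D) p q
      D-connected p q p∈D q∈D with reach? (_∈? D) p q
      ... | yes p⇝q = p⇝q
      ... | no ¬p⇝q = contradiction (p , q , p∈D , q∈D , ¬p⇝q) ¬split

    -- if D is connected and contains no cut vertex of G, then D ∪ {c} is an end block avoiding o
    module _ (noCut : ∀ w → w ∈ D → ConnectedSet G (⊤ - w))
             (D-connected : ∀ p q → p ∈ D → q ∈ D → Reach (_∈ D) p q) where

      B : Subset n
      B = D ∪ ⁅ c ⁆

      c∈B : c ∈ B
      c∈B = ∈∪⁅⁆⁺ (inj₂ refl)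

      D⊆B : D ⊆ B
      D⊆B z∈D = ∈∪⁅⁆⁺ (inj₁ z∈D)

      D∌c : ∀ {z} → z ∈ D → z ≢ c
      D∌c z∈D refl = c∉D z∈D

      -- a vertex of D reaches c inside B along the beginning of any walk to o
      toC-in-B : ∀ {P : Fin n → Set} {a vs} → WalkList G a o vs → All P vs → a ∈ D → Reach (λ z → P z × z ∈ B) a c
      toC-in-B a⇝o ps a∈D = reach-map (λ (pz , z∈) → pz , ∈∪⁅⁆⁺ z∈) (escape closed a⇝o ps a∈D o∉D)

      B-connected : ConnectedSet G B
      B-connected p q p∈B q∈B = reach-trans (toC' p∈B) (reach-sym (toC' q∈B))
        where
        toC' : ∀ {p} → p ∈ B → Reach (_∈ B) p c
        toC' {p} p∈B with ∈∪⁅⁆⁻ p∈B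
        ... | inj₂ refl = reach-refl c∈B
        ... | inj₁ p∈D = let (_ , p⇝o , ps) = connected p o ∈⊤ ∈⊤ in reach-map proj₂ (toC-in-B p⇝o ps p∈D)

      B-connected-minus : ∀ v → v ∈ B → ConnectedSet G (B - v)
      B-connected-minus v v∈B with ∈∪⁅⁆⁻ v∈B
      ... | inj₂ refl = λ p q p∈ q∈ →
              reach-map (λ z∈D → x∈p∧x≢y⇒x∈p-y (D⊆B z∈D) (D∌c z∈D)) (D-connected p q (inD p∈) (inD q∈))
        where
        inD : ∀ {p} → p ∈ B - c → p ∈ D
        inD p∈ = [ (λ p∈D → p∈D) , (λ p≡c → contradiction p≡c (x∈p-y⇒x≢y B p∈)) ]′ (∈∪⁅⁆⁻ (x∈p-y⇒x∈p B p∈))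
      ... | inj₁ v∈D = λ p q p∈ q∈ → reach-trans (toC' p∈) (reach-sym (toC' q∈))
        where
        toC' : ∀ {p} → p ∈ B - v → Reach (_∈ B - v) p c
        toC' {p} p∈ with ∈∪⁅⁆⁻ (x∈p-y⇒x∈p B p∈)
        ... | inj₂ refl = reach-refl p∈
        ... | inj₁ p∈D =
          let (_ , p⇝o , ps) = noCut v v∈D p o (∈⊤- (x∈p-y⇒x≢y B p∈)) (∈⊤- λ { refl → o∉D v∈D })
          in reach-map (λ (z∈⊤-v , z∈B) → x∈p∧x≢y⇒x∈p-y z∈B (x∈p-y⇒x≢y ⊤ z∈⊤-v)) (toC-in-B p⇝o ps p∈D)

      -- a vertex z outside B would be cut off from d by c, so B' ∋ z would be separable
      B-maximal : ∀ B' → B ⊆ B' → Nonseparable G B' → B' ⊆ B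
      B-maximal B' B⊆B' (_ , B'-minus-connected) {z} z∈B' with z ∈? B
      ... | yes z∈B = z∈B
      ... | no z∉B =
        let (_ , d⇝z , ps) = B'-minus-connected c (B⊆B' c∈B) d z (x∈p∧x≢y⇒x∈p-y (B⊆B' (D⊆B d∈D)) (D∌c d∈D))
                                                 (x∈p∧x≢y⇒x∈p-y z∈B' λ { refl → z∉B c∈B })
            (_ , d⇝c , ps') = escape closed d⇝z ps d∈D (λ z∈D → z∉B (D⊆B z∈D))
        in contradiction refl (x∈p-y⇒x≢y B' (proj₁ (walk-end d⇝c ps')))

      endBlock : EndBlock G B
      endBlock = ((c , c∈B) , (B-connected , B-connected-minus) , B-maximal) , onlyCut
        where
        cut⇒c : ∀ {u} → u ∈ B → CutVertex G u → u ≡ c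
        cut⇒c {u} u∈B cut = [ (λ u∈D → contradiction (noCut u u∈D) cut) , (λ u≡c → u≡c) ]′ (∈∪⁅⁆⁻ u∈B)
        onlyCut : ∀ u v → u ∈ B → v ∈ B → CutVertex G u → CutVertex G v → u ≡ v
        onlyCut u v u∈B v∈B cut-u cut-v = trans (cut⇒c u∈B cut-u) (sym (cut⇒c v∈B cut-v))

      o∉B : o ∉ B
      o∉B o∈B = [ o∉D , (λ o≡c → c≢o (sym o≡c)) ]′ (∈∪⁅⁆⁻ o∈B)

  branch⇒endBlock : ∀ {c D} → Branch c D → ∃[ B ] (EndBlock G B × o ∉ B)
  branch⇒endBlock {D = D} = within (suc ∣ D ∣) ≤-refl
    where
    within : ∀ m {c D} → ∣ D ∣ < m → Branch c D → ∃[ B ] (EndBlock G B × o ∉ B)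
    within (suc m) ∣D∣<1+m br with cutOrSmaller br | connOrSmaller br
    ... | inj₁ (_ , _ , smaller , br') | _ = within m (<-≤-trans smaller (s≤s⁻¹ ∣D∣<1+m)) br'
    ... | inj₂ _ | inj₁ (_ , _ , smaller , br') = within m (<-≤-trans smaller (s≤s⁻¹ ∣D∣<1+m)) br'
    ... | inj₂ noCut | inj₂ D-connected = _ , endBlock br noCut D-connected , o∉B br noCut D-connected

module _ {n : ℕ} (G : Graph n) where
  open Walks G

  -- If no vertex of H - x had a neighbour in the component C of G - H containing y, then
  -- D = V(G) - (C ∪ {x}) ∋ s would be a branch cut off by x; it would contain an end block
  -- avoiding y in which x is a cut vertex, which 2-connectivity of (G, x, y) forbids.
  attachment : ∀ {x y s : Fin n} (H : Subset n) → TwoConnectedRooted G x y → y ∉ H → s ∈ H → s ≢ x →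
               ∃[ z ] ∃[ c ] ((z ∈ H × z ≢ x) × Adj G z c × ReachIn G (∁ H) y c)
  attachment {x} {y} {s} H (x≢y , connected , _ , _ , endBlocks) y∉H s∈H s≢x
    with any? (λ z → any? (λ c → ((z ∈? H) ×-dec ¬? (z ≟ x)) ×-dec adj? z c ×-dec reach? (_∈? ∁ H) y c))
  ... | yes attached = attached
  ... | no ¬attached =
    let (B , endBlock , y∉B) = branch⇒endBlock branch
    in ⊥-elim ([ (λ (_ , x-not-cut) → x-not-cut (branch⇒cut branch)) , (λ (y∈B , _) → y∉B y∈B) ]′ (endBlocks B endBlock))
    where
    open Branches G connected y

    C : Subset n
    C = subsetOf (reach? (_∈? ∁ H) y)

    C⊆∁H : ∀ {z} → z ∈ C → z ∈ ∁ H
    C⊆∁H z∈C = let (_ , y⇝z , ps) = ∈-subsetOf⁻ (reach? (_∈? ∁ H) y) z∈C in walk-end y⇝z ps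

    D : Subset n
    D = ∁ (C ∪ ⁅ x ⁆)

    closedD : Closed D x
    closedD {u} {w} u∈D uw with w ∈? C
    ... | no w∉C with w ≟ x
    ...   | yes w≡x = inj₂ w≡x
    ...   | no w≢x = inj₁ (∈∁∪⁅⁆⁺ w∉C w≢x)
    closedD {u} {w} u∈D uw | yes w∈C with u ∈? H
    ...   | yes u∈H = ⊥-elim (¬attached (u , w , (u∈H , proj₂ (∈∁∪⁅⁆⁻ u∈D)) , uw , ∈-subsetOf⁻ (reach? (_∈? ∁ H) y) w∈C))
    ...   | no u∉H = ⊥-elim (proj₁ (∈∁∪⁅⁆⁻ u∈D) (∈-subsetOf⁺ (reach? (_∈? ∁ H) y)
                       (reach-trans (∈-subsetOf⁻ (reach? (_∈? ∁ H) y) w∈C) (reach-edge (C⊆∁H w∈C) (x∉p⇒x∈∁p u∉H) (adj-sym uw)))))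

    branch : Branch x D
    branch = record
      { c≢o = x≢y
      ; o∉D = λ y∈D → proj₁ (∈∁∪⁅⁆⁻ y∈D) (∈-subsetOf⁺ (reach? (_∈? ∁ H) y) (reach-refl (x∉p⇒x∈∁p y∉H)))
      ; c∉D = λ x∈D → proj₂ (∈∁∪⁅⁆⁻ x∈D) refl
      ; d = s
      ; d∈D = ∈∁∪⁅⁆⁺ (λ s∈C → x∈∁p⇒x∉p (C⊆∁H s∈C) s∈H) s≢x
      ; closed = closedD
      }

-- Ladders in a complete bipartite graph G[S, T] with x ∈ S and y ∉ T

module Ladder {n : ℕ} (G : Graph n) (S T : Subset n) (x y : Fin n)
              (S∩T≡∅ : ∀ v → v ∈ S → v ∉ T) (complete : ∀ s t → s ∈ S → t ∈ T → Adj G s t)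
              (x∈S : x ∈ S) (y∉T : y ∉ T) where
  open Walks G

  ladderWalk : ∀ {s₀ t₀ tl} ts ss → s₀ ∈ S → All (_∈ T) ts → All (_∈ S) ss → t₀ ∈ T → WalkList G t₀ y tl →
               WalkList G s₀ y (s₀ ∷ interleave ts ss ++ tl)
  ladderWalk (t ∷ ts) (s ∷ ss) s₀∈S (t∈T ∷ ts⊆T) (s∈S ∷ ss⊆S) t₀∈T t₀⇝y =
    cons (complete _ t s₀∈S t∈T) (cons (adj-sym (complete s t s∈S t∈T)) (ladderWalk ts ss s∈S ts⊆T ss⊆S t₀∈T t₀⇝y))
  ladderWalk [] _ s₀∈S _ _ t₀∈T t₀⇝y = cons (complete _ _ s₀∈S t₀∈T) t₀⇝y
  ladderWalk (_ ∷ _) [] s₀∈S _ _ t₀∈T t₀⇝y = cons (complete _ _ s₀∈S t₀∈T) t₀⇝y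

  -- admissible rungs, given the region Q occupied by the tail: off Q, in T resp. in S - x
  TRung SRung : (Fin n → Set) → Fin n → Set
  TRung Q v = v ∈ T × ¬ Q v
  SRung Q v = v ∈ S - x × ¬ Q v

  -- a ladder path repeats no vertex: T separates the two kinds of rungs, the rungs lie off
  -- the tail region Q, and x is neither a rung nor in Q
  rung-unique : ∀ {Q : Fin n → Set} {ts ss tl} → ¬ Q x → All (TRung Q) ts → All (SRung Q) ss →
                Unique ts → Unique ss → Unique tl → All Q tl → Unique (x ∷ interleave ts ss ++ tl)
  rung-unique {Q} {ts} {ss} {tl} ¬Qx ts-ok ss-ok uts uss utl tl⊆Q =
    All.++⁺ (interleave-All (All.map x≢t ts-ok) (All.map x≢s ss-ok)) (All.map x≢q tl⊆Q)
    ∷ Unique.++⁺ (interleave-unique T (All.map proj₁ ts-ok) (All.map (λ (v∈S-x , _) → S∩T≡∅ _ (x∈p-y⇒x∈p S v∈S-x)) ss-ok) uts uss)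
                 utl disjoint
    where
    x≢t : ∀ {v} → TRung Q v → x ≢ v
    x≢t (v∈T , _) x≡v = S∩T≡∅ x x∈S (subst (_∈ T) (sym x≡v) v∈T)
    x≢s : ∀ {v} → SRung Q v → x ≢ v
    x≢s (v∈S-x , _) = ≢-sym (x∈p-y⇒x≢y S v∈S-x)
    x≢q : ∀ {v} → Q v → x ≢ v
    x≢q Qv x≡v = ¬Qx (subst Q (sym x≡v) Qv)
    disjoint : Disjoint (interleave ts ss) tl
    disjoint (v∈rungs , v∈tl) =
      All.lookup (interleave-All (All.map proj₂ ts-ok) (All.map proj₂ ss-ok)) v∈rungs (All.lookup tl⊆Q v∈tl)

  -- With a tail path inside Q from t₀ ∈ T to y and at least k - 1 rungs on each side, the
  -- paths  x t₁ s₁ … tᵢ sᵢ t₀ … y  (0 ≤ i < k)  have lengths 2i + |tail| and so satisfy the length condition.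
  ladderPaths : ∀ {Q : Fin n → Set} {t₀} k (ts ss : List (Fin n)) → ¬ Q x → t₀ ∈ T → PathIn Q t₀ y →
                Unique ts → Unique ss → All (TRung Q) ts → All (SRung Q) ss →
                k ≤ suc (length ts) → k ≤ suc (length ss) → LengthCondPaths G x y k
  ladderPaths k ts ss ¬Qx t₀∈T (tl , t₀⇝y , utl , tl⊆Q) uts uss ts-ok ss-ok k≤ts k≤ss = path , first , step
    where
    L : ℕ
    L = length tl

    rungs : ℕ → List (Fin n)
    rungs i = interleave (take i ts) (take i ss)

    path : Fin k → Path G x y
    path i = x ∷ rungs j ++ tl
           , ladderWalk (take j ts) (take j ss) x∈S (All.take⁺ j (All.map proj₁ ts-ok))
                        (All.take⁺ j (All.map (λ (v∈S-x , _) → x∈p-y⇒x∈p S v∈S-x) ss-ok)) t₀∈T t₀⇝y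
           , rung-unique ¬Qx (All.take⁺ j ts-ok) (All.take⁺ j ss-ok) (Unique.take⁺ j uts) (Unique.take⁺ j uss) utl tl⊆Q
      where
      j = toℕ i

    fits : ∀ {m} (i : Fin k) → k ≤ suc m → toℕ i ≤ m
    fits i k≤1+m = s≤s⁻¹ (<-≤-trans (toℕ<n i) k≤1+m)

    length-path : ∀ i → len G (path i) ≡ toℕ i + toℕ i + L
    length-path i = trans (length-++ (rungs (toℕ i)))
                          (cong (_+ L) (length-interleave-take (toℕ i) ts ss (fits i k≤ts) (fits i k≤ss)))

    first : ∀ i → toℕ i ≡ 0 → 2 ≤ len G (path i)
    first i _ = ≤-trans (walk-length (λ { refl → y∉T t₀∈T }) t₀⇝y)
                        (subst (L ≤_) (sym (length-path i)) (m≤n+m L (toℕ i + toℕ i)))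

    step : ∀ i j → toℕ j ≡ suc (toℕ i) → len G (path j) ≡ len G (path i) + 2
    step i j j≡1+i = begin
      len G (path j)                  ≡⟨ length-path j ⟩
      toℕ j + toℕ j + L               ≡⟨ cong (λ m → m + m + L) j≡1+i ⟩
      suc (toℕ i) + suc (toℕ i) + L   ≡⟨ cong (λ m → suc m + L) (+-suc (toℕ i) (toℕ i)) ⟩
      2 + (toℕ i + toℕ i + L)         ≡⟨ +-comm 2 (toℕ i + toℕ i + L) ⟩
      toℕ i + toℕ i + L + 2           ≡⟨ cong (_+ 2) (length-path i) ⟨
      len G (path i) + 2              ∎
      where open ≡-Reasoning

module CorePaths {n : ℕ} (G : Graph n) (x y : Fin n) (l : ℕ) (S T : Subset n)
                 (S∩T≡∅ : ∀ v → v ∈ S → v ∉ T) (complete : ∀ s t → s ∈ S → t ∈ T → Adj G s t)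
                 (∣S∣≡1+l : ∣ S ∣ ≡ suc l) (∣S∣≤∣T∣ : ∣ S ∣ ≤ ∣ T ∣) (x∈S : x ∈ S) (y∉H : y ∉ S ∪ T) where
  open Walks G
  open import Data.Nat.Properties using (module ≤-Reasoning)

  H : Subset n
  H = S ∪ T

  inS : ∀ {v} → v ∈ S → v ∈ H
  inS v∈S = x∈p∪q⁺ (inj₁ v∈S)

  inT : ∀ {v} → v ∈ T → v ∈ H
  inT v∈T = x∈p∪q⁺ (inj₂ v∈T)

  S≢T : ∀ {v w} → v ∈ S → w ∈ T → v ≢ w
  S≢T v∈S w∈T refl = S∩T≡∅ _ v∈S w∈T

  open Ladder G S T x y S∩T≡∅ complete x∈S (λ y∈T → y∉H (inT y∈T))

  -- the region of a tail that enters ∁ H from z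
  Tail : Fin n → Fin n → Set
  Tail z v = v ∈ ∁ H ⊎ v ≡ z

  off-tail : ∀ {v z} → v ∈ H → v ≢ z → ¬ Tail z v
  off-tail v∈H _ (inj₁ v∈∁H) = x∈∁p⇒x∉p v∈∁H v∈H
  off-tail _ v≢z (inj₂ v≡z) = v≢z v≡z

  tailFrom : ∀ {z c} → z ∈ H → Adj G z c → ReachIn G (∁ H) y c → PathIn (Tail z) z y
  tailFrom z∈H zc y⇝c = let (_ , c⇝y , ps) = reach-sym y⇝c in extend (x∈p⇒x∉∁p z∈H) zc (shorten c⇝y ps)

  -- an attachment at z ∈ T: rungs from T - z and S - x, tail z c … y; up to l + 1 paths
  viaT : ∀ k {z c} → z ∈ T → Adj G z c → ReachIn G (∁ H) y c → k ≤ suc l → LengthCondPaths G x y k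
  viaT k {z} z∈T zc y⇝c k≤1+l =
    ladderPaths k (elements (T - z)) (elements (S - x)) (off-tail (inS x∈S) (S≢T x∈S z∈T)) z∈T (tailFrom (inT z∈T) zc y⇝c)
                (elements-unique (T - z)) (elements-unique (S - x))
                (All.map tRung (elements⊆ (T - z))) (All.map sRung (elements⊆ (S - x))) k≤ts k≤ss
    where
    tRung : ∀ {v} → v ∈ T - z → TRung (Tail z) v
    tRung v∈ = x∈p-y⇒x∈p T v∈ , off-tail (inT (x∈p-y⇒x∈p T v∈)) (x∈p-y⇒x≢y T v∈)
    sRung : ∀ {v} → v ∈ S - x → SRung (Tail z) v
    sRung v∈ = v∈ , off-tail (inS (x∈p-y⇒x∈p S v∈)) (S≢T (x∈p-y⇒x∈p S v∈) z∈T)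
    open ≤-Reasoning
    k≤ts : k ≤ suc (length (elements (T - z)))
    k≤ts = begin
      k                                ≤⟨ k≤1+l ⟩
      suc l                            ≡⟨ ∣S∣≡1+l ⟨
      ∣ S ∣                            ≤⟨ ∣S∣≤∣T∣ ⟩
      ∣ T ∣                            ≤⟨ ∣p∣≤1+∣p-x∣ T z ⟩
      suc ∣ T - z ∣                    ≡⟨ cong suc (length-elements (T - z)) ⟨
      suc (length (elements (T - z)))  ∎
    k≤ss : k ≤ suc (length (elements (S - x)))
    k≤ss = begin
      k                                ≤⟨ k≤1+l ⟩
      suc l                            ≡⟨ ∣S∣≡1+l ⟨
      ∣ S ∣                            ≤⟨ ∣p∣≤1+∣p-x∣ S x ⟩
      suc ∣ S - x ∣                    ≡⟨ cong suc (length-elements (S - x)) ⟨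
      suc (length (elements (S - x)))  ∎

  -- an attachment at z ∈ S - x: pick t ∈ T; rungs from T - t and S - x - z, tail t z c … y; up to l paths
  viaS : ∀ k {z c} → z ∈ S → z ≢ x → Adj G z c → ReachIn G (∁ H) y c → k ≤ l → LengthCondPaths G x y k
  viaS k {z} z∈S z≢x zc y⇝c k≤l =
    ladderPaths k (elements (T - t)) (elements (S - x - z)) (off x∈S (≢-sym z≢x) (S≢T x∈S t∈T)) t∈T tail
                (elements-unique (T - t)) (elements-unique (S - x - z))
                (All.map tRung (elements⊆ (T - t))) (All.map sRung (elements⊆ (S - x - z))) k≤ts k≤ss
    where
    open ≤-Reasoning
    1≤∣T∣ : 1 ≤ ∣ T ∣
    1≤∣T∣ = ≤-trans (s≤s z≤n) (subst (_≤ ∣ T ∣) ∣S∣≡1+l ∣S∣≤∣T∣)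
    t = proj₁ (size⇒nonempty 1≤∣T∣)
    t∈T = proj₂ (size⇒nonempty 1≤∣T∣)
    Region : Fin n → Set
    Region v = Tail z v ⊎ v ≡ t
    off : ∀ {v} → v ∈ S → v ≢ z → v ≢ t → ¬ Region v
    off v∈S v≢z v≢t = [ off-tail (inS v∈S) v≢z , v≢t ]′
    tail : PathIn Region t y
    tail = extend (off-tail (inT t∈T) (≢-sym (S≢T z∈S t∈T))) (adj-sym (complete z t z∈S t∈T)) (tailFrom (inS z∈S) zc y⇝c)
    tRung : ∀ {v} → v ∈ T - t → TRung Region v
    tRung v∈ = let v∈T = x∈p-y⇒x∈p T v∈ in
      v∈T , [ off-tail (inT v∈T) (≢-sym (S≢T z∈S v∈T)) , x∈p-y⇒x≢y T v∈ ]′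
    sRung : ∀ {v} → v ∈ S - x - z → SRung Region v
    sRung v∈ = let v∈S-x = x∈p-y⇒x∈p (S - x) v∈ ; v∈S = x∈p-y⇒x∈p S v∈S-x in
      v∈S-x , off v∈S (x∈p-y⇒x≢y (S - x) v∈) (S≢T v∈S t∈T)
    k≤ts : k ≤ suc (length (elements (T - t)))
    k≤ts = begin
      k                                ≤⟨ m≤n⇒m≤1+n k≤l ⟩
      suc l                            ≡⟨ ∣S∣≡1+l ⟨
      ∣ S ∣                            ≤⟨ ∣S∣≤∣T∣ ⟩
      ∣ T ∣                            ≤⟨ ∣p∣≤1+∣p-x∣ T t ⟩
      suc ∣ T - t ∣                    ≡⟨ cong suc (length-elements (T - t)) ⟨
      suc (length (elements (T - t)))  ∎
    k≤ss : k ≤ suc (length (elements (S - x - z)))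
    k≤ss = s≤s⁻¹ (begin
      suc k                                      ≤⟨ s≤s k≤l ⟩
      suc l                                      ≡⟨ ∣S∣≡1+l ⟨
      ∣ S ∣                                      ≤⟨ ∣p∣≤1+∣p-x∣ S x ⟩
      suc ∣ S - x ∣                              ≤⟨ s≤s (∣p∣≤1+∣p-x∣ (S - x) z) ⟩
      suc (suc ∣ S - x - z ∣)                    ≡⟨ cong (λ m → suc (suc m)) (length-elements (S - x - z)) ⟨
      suc (suc (length (elements (S - x - z))))  ∎)

-- The theorem: case (ii) supplies an edge from T into the y-component, while in case (i)
-- an edge from H - x exists by 2-connectivity; either way the ladder yields k paths.
lemma1 : ∀ {n} (G : Graph n) (x y : Fin n) (k l : ℕ) (S T : Subset n) →
    1 ≤ k →
    TwoConnectedRooted G x y →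
    IsCore G x y l S T →
    (k ≤ l
      ⊎ (suc l ≡ k
         × ∃[ t ] ∃[ c ] (t ∈ T × ReachIn G (∁ (S ∪ T)) y c × Adj G t c))) →
    LengthCondPaths G x y k
lemma1 G x y k l S T _ 2-connected (S∩T≡∅ , complete , ∣S∣≡1+l , 2≤∣S∣ , ∣S∣≤∣T∣ , x∈S , y∉H , _) =
  [ viaAttachment , (λ (1+l≡k , _ , _ , t∈T , y⇝c , tc) → viaT k t∈T tc y⇝c (≤-reflexive (sym 1+l≡k))) ]′
  where
  open CorePaths G x y l S T S∩T≡∅ complete ∣S∣≡1+l ∣S∣≤∣T∣ x∈S y∉H
  viaAttachment : k ≤ l → LengthCondPaths G x y k
  viaAttachment k≤l with other-element S x 2≤∣S∣
  ... | s , s∈S , s≢x with attachment G H 2-connected y∉H (inS s∈S) s≢x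
  ...   | z , _ , (z∈H , z≢x) , zc , y⇝c =
    [ (λ z∈S → viaS k z∈S z≢x zc y⇝c k≤l) , (λ z∈T → viaT k z∈T zc y⇝c (m≤n⇒m≤1+n k≤l)) ]′ (x∈p∪q⁻ S T z∈H)
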